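{- Let $T$ be a rooted ordered tree with $n$ vertices and $\sigma=\Theta(T)$. Then there are at most $n-1$ distinct deletion operations applicable to $\sigma$ and at most $3n^3$ distinct insertion operations applicable to $\sigma$.
   Context: Permutations are written as words. For a rooted ordered tree $T$ with $m$ edges, $\Theta(T)$ is the permutation of $\{1,\dots,m\}$ obtained by labelling the edges $1,\dots,m$ in postfix depth-first order (children left to right; the edge to $v$ is labelled after all edges below $v$) and reading these labels in prefix depth-first order (the edge to $v$ is read when $v$ is first reached). A factor of $\sigma$ is a word of consecutive letters; it is compact if its letters form an integer interval; a factor $f$ is complete if it is compact and there is no nonempty factor $g$ with $fg$ a factor of $\sigma$ that is compact and has the same largest letter as $f$. For a word $w$ and integer $a$, $\overline{w}^{a}$ is obtained by adding $1$ to each letter $\ge a$. A deletion operation $(\sigma_k\to\Lambda)$, for a position $k$, removes $\sigma_k$ and decreases by $1$ all letters greater than $\sigma_k$. Insertion operations: $(\Lambda\to\varnothing)$ maps the empty word to $(1)$; for $\sigma=ufv$ nonempty and $f$ a complete factor, $(\Lambda\to f)$ gives $\overline{u}^{a}af\overline{v}^{a}$ and $(\Lambda\overset{r}{\to}f)$ gives $\overline{u}^{a}fa\overline{v}^{a}$, with $a=\max f+1$, and $(\Lambda\overset{l}{\to}f)$ gives $\overline{u}^{a}a\overline{f}^{a}\overline{v}^{a}$ with $a=\min f$; an insertion operation is thus specified by its type and the complete factor $f$. -}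

module Defs where

open import Data.Nat using (ℕ; zero; suc; _+_; _⊔_; _≤_)
open import Data.List using (List; []; _∷_; _++_; length)
open import Data.List.Relation.Binary.Permutation.Propositional using (_↭_)
open import Data.Product using (Σ; ∃; ∃-syntax; _×_; _,_)
open import Relation.Binary.PropositionalEquality using (_≡_; _≢_)
open import Relation.Nullary using (¬_)

data Tree : Set where
  node : List Tree → Tree

mutual
  vertices : Tree → ℕ
  vertices (node cs) = suc (verticesL cs)

  verticesL : List Tree → ℕ
  verticesL []       = 0
  verticesL (c ∷ cs) = vertices c + verticesL cs

mutual
  edges : Tree → ℕ
  edges (node cs) = edgesL cs

  edgesL : List Tree → ℕ
  edgesL []       = 0
  edgesL (c ∷ cs) = suc (edges c) + edgesL cs

-- Θ(T): label edges 1..m in postfix DFS order (edge to v labelled after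
-- all edges below v), read the labels in prefix DFS order (edge to v read
-- when v is first reached).  'o' is the number of labels already used.

mutual
  thetaFrom : ℕ → Tree → List ℕ
  thetaFrom o (node cs) = thetaL o cs

  thetaL : ℕ → List Tree → List ℕ
  thetaL o []       = []
  thetaL o (c ∷ cs) =
    (o + suc (edges c)) ∷ (thetaFrom o c ++ thetaL (o + suc (edges c)) cs)

Θ : Tree → List ℕ
Θ = thetaFrom 0

range : ℕ → ℕ → List ℕ
range a zero    = []
range a (suc k) = a ∷ range (suc a) k

-- largest letter (letters of permutations are ≥ 1)
maxL : List ℕ → ℕ
maxL []       = 0
maxL (x ∷ xs) = x ⊔ maxL xs

IsFactor : List ℕ → List ℕ → Set
IsFactor f σ = ∃[ u ] ∃[ v ] (u ++ f ++ v ≡ σ)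

Compact : List ℕ → Set
Compact f = ∃[ a ] (f ↭ range a (length f))

Complete : List ℕ → List ℕ → Set
Complete f σ =
  IsFactor f σ × Compact f ×
  ¬ (∃[ g ] (g ≢ [] × IsFactor (f ++ g) σ × Compact (f ++ g)
             × maxL (f ++ g) ≡ maxL f))

-- deletion operation (σ_k → Λ), k a position (1-based)
data DelOp : Set where
  del : ℕ → DelOp

DelApplicable : List ℕ → DelOp → Set
DelApplicable σ (del k) = (1 ≤ k) × (k ≤ length σ)

data InsOp : Set where
  insEmpty : InsOp
  ins      : List ℕ → InsOp
  insR     : List ℕ → InsOp
  insL     : List ℕ → InsOp

InsApplicable : List ℕ → InsOp → Set
InsApplicable σ insEmpty = σ ≡ []
InsApplicable σ (ins f)  = σ ≢ [] × f ≢ [] × Complete f σ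
InsApplicable σ (insR f) = σ ≢ [] × f ≢ [] × Complete f σ
InsApplicable σ (insL f) = σ ≢ [] × f ≢ [] × Complete f σ

{-# OPTIONS --safe #-}
module Submission where

open import Defs
open import Data.Fin using (Fin; zero; suc)
open import Data.Fin.Properties using (injective⇒≤)
open import Data.Nat using (ℕ; zero; suc; _+_; _*_; _^_; _∸_; _≤_; z≤n; s≤s)
open import Data.Nat.Properties using (+-identityʳ; +-monoʳ-≤; *-monoʳ-≤; n≤1+n; m≤m+n; ≤-trans; module ≤-Reasoning)
open import Data.Nat.Tactic.RingSolver using (solve-∀)
open import Data.List using (List; []; _∷_; _++_; length; lookup; map; applyUpTo; module Inits)
open import Data.List.Properties using (length-++; length-map; length-applyUpTo)
open import Data.List.Relation.Unary.All as All using (All)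
open import Data.List.Relation.Unary.Any using (here; there; index)
open import Data.List.Relation.Unary.Any.Properties using (lookup-index)
open import Data.List.Relation.Unary.AllPairs using (_∷_)
open import Data.List.Relation.Unary.Unique.Propositional using (Unique)
open import Data.List.Membership.Propositional using (_∈_)
open import Data.List.Membership.Propositional.Properties
  using (∈-lookup; ∈-map⁺; ∈-++⁺ˡ; ∈-++⁺ʳ; ∈-applyUpTo⁺)
open import Data.List.Relation.Binary.Subset.Propositional using (_⊆_)
open import Data.Product using (_×_; _,_)
open import Data.Empty using (⊥-elim)
open import Function using (_∘_)
open import Relation.Binary.PropositionalEquality using (_≡_; _≢_; refl; sym; trans; cong; cong₂; subst; module ≡-Reasoning)

-- Both bounds are pigeonhole counts.  Θ(T) has one letter per edge, i.e. n − 1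
-- letters, and a deletion is determined by a position of Θ(T).  An insertion is
-- (Λ → ∅) or is determined by one of three types and a nonempty factor of Θ(T),
-- of which there are at most (n − 1)²; and 1 + 3(n − 1)² ≤ 3n³.

module _ {A : Set} where

  Unique-lookup-injective : ∀ {xs : List A} → Unique xs →
                            ∀ {i j} → lookup xs i ≡ lookup xs j → i ≡ j
  Unique-lookup-injective {_ ∷ _} _             {zero}  {zero}  _  = refl
  Unique-lookup-injective {_ ∷ _} (x∉xs ∷ _)    {zero}  {suc j} eq = ⊥-elim (All.lookup x∉xs (∈-lookup j) eq)
  Unique-lookup-injective {_ ∷ _} (x∉xs ∷ _)    {suc i} {zero}  eq = ⊥-elim (All.lookup x∉xs (∈-lookup i) (sym eq))
  Unique-lookup-injective {_ ∷ _} (_ ∷ xs-uniq) {suc i} {suc j} eq = cong suc (Unique-lookup-injective xs-uniq eq)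

  Unique-⊆⇒length≤ : ∀ {xs ys : List A} → Unique xs → xs ⊆ ys → length xs ≤ length ys
  Unique-⊆⇒length≤ {xs} {ys} xs-uniq xs⊆ys = injective⇒≤ position-injective
    where
    position : Fin (length xs) → Fin (length ys)
    position i = index (xs⊆ys (∈-lookup i))

    position-injective : ∀ {i j} → position i ≡ position j → i ≡ j
    position-injective {i} {j} eq = Unique-lookup-injective xs-uniq (begin
      lookup xs i                    ≡⟨ lookup-index (xs⊆ys (∈-lookup i)) ⟩
      lookup ys (position i)         ≡⟨ cong (lookup ys) eq ⟩
      lookup ys (position j)         ≡⟨ sym (lookup-index (xs⊆ys (∈-lookup j))) ⟩
      lookup xs j                    ∎)
      where open ≡-Reasoning

  Unique-All⇒length≤ : ∀ {P : A → Set} (ys : List A) → (∀ {x} → P x → x ∈ ys) →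
                       ∀ {xs} → Unique xs → All P xs → length xs ≤ length ys
  Unique-All⇒length≤ ys P⊆ys xs-uniq all = Unique-⊆⇒length≤ xs-uniq (P⊆ys ∘ All.lookup all)

mutual
  vertices≡suc-edges : (t : Tree) → vertices t ≡ suc (edges t)
  vertices≡suc-edges (node cs) = cong suc (verticesL≡edgesL cs)

  verticesL≡edgesL : (cs : List Tree) → verticesL cs ≡ edgesL cs
  verticesL≡edgesL []       = refl
  verticesL≡edgesL (c ∷ cs) = cong₂ _+_ (vertices≡suc-edges c) (verticesL≡edgesL cs)

mutual
  length-thetaFrom : (o : ℕ) (t : Tree) → length (thetaFrom o t) ≡ edges t
  length-thetaFrom o (node cs) = length-thetaL o cs

  length-thetaL : (o : ℕ) (cs : List Tree) → length (thetaL o cs) ≡ edgesL cs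
  length-thetaL o []       = refl
  length-thetaL o (c ∷ cs) = cong suc (trans (length-++ (thetaFrom o c))
    (cong₂ _+_ (length-thetaFrom o c) (length-thetaL (o + suc (edges c)) cs)))

vertices≡suc-length-Θ : (T : Tree) → vertices T ≡ suc (length (Θ T))
vertices≡suc-length-Θ T = trans (vertices≡suc-edges T) (cong suc (sym (length-thetaFrom 0 T)))

deletions : ℕ → List DelOp
deletions = applyUpTo (del ∘ suc)

DelApplicable⇒∈deletions : ∀ {σ op} → DelApplicable σ op → op ∈ deletions (length σ)
DelApplicable⇒∈deletions {op = del (suc k)} (_ , k<∣σ∣) = ∈-applyUpTo⁺ (del ∘ suc) k<∣σ∣

applicable-deletions-count : ∀ σ {ops} → Unique ops → All (DelApplicable σ) ops →
                             length ops ≤ length σ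
applicable-deletions-count σ ops-uniq applicable =
  subst (_ ≤_) (length-applyUpTo (del ∘ suc) (length σ))
    (Unique-All⇒length≤ (deletions (length σ)) DelApplicable⇒∈deletions ops-uniq applicable)

module _ {A : Set} where

  nonemptyFactors : List A → List (List A)
  nonemptyFactors []       = []
  nonemptyFactors (x ∷ xs) = Inits.tail (x ∷ xs) ++ nonemptyFactors xs

  length-Inits-tail : (xs : List A) → length (Inits.tail xs) ≡ length xs
  length-Inits-tail []       = refl
  length-Inits-tail (x ∷ xs) = cong suc (trans (length-map (x ∷_) (Inits.tail xs)) (length-Inits-tail xs))

  length-nonemptyFactors : (xs : List A) → length (nonemptyFactors xs) ≤ length xs * length xs
  length-nonemptyFactors []       = z≤n
  length-nonemptyFactors (x ∷ xs) = begin
    length (Inits.tail (x ∷ xs) ++ nonemptyFactors xs)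
      ≡⟨ length-++ (Inits.tail (x ∷ xs)) ⟩
    length (Inits.tail (x ∷ xs)) + length (nonemptyFactors xs)
      ≡⟨ cong (_+ length (nonemptyFactors xs)) (length-Inits-tail (x ∷ xs)) ⟩
    suc n + length (nonemptyFactors xs)
      ≤⟨ +-monoʳ-≤ (suc n) (length-nonemptyFactors xs) ⟩
    suc n + n * n
      ≤⟨ +-monoʳ-≤ (suc n) (*-monoʳ-≤ n (n≤1+n n)) ⟩
    suc n * suc n
      ∎
    where
    open ≤-Reasoning
    n = length xs

  ∈-Inits-tail : ∀ y f (v : List A) → y ∷ f ∈ Inits.tail (y ∷ f ++ v)
  ∈-Inits-tail y []      v = here refl
  ∈-Inits-tail y (z ∷ f) v = there (∈-map⁺ (y ∷_) (∈-Inits-tail z f v))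

  ∈-nonemptyFactors : ∀ u y f (v : List A) → y ∷ f ∈ nonemptyFactors (u ++ y ∷ f ++ v)
  ∈-nonemptyFactors []      y f v = ∈-++⁺ˡ (∈-Inits-tail y f v)
  ∈-nonemptyFactors (w ∷ u) y f v = ∈-++⁺ʳ (Inits.tail (w ∷ u ++ y ∷ f ++ v)) (∈-nonemptyFactors u y f v)

IsFactor⇒∈nonemptyFactors : ∀ {f σ} → f ≢ [] → IsFactor f σ → f ∈ nonemptyFactors σ
IsFactor⇒∈nonemptyFactors {[]}    f≢[] _              = ⊥-elim (f≢[] refl)
IsFactor⇒∈nonemptyFactors {y ∷ f} _    (u , v , refl) = ∈-nonemptyFactors u y f v

insertionCandidates : List ℕ → List InsOp
insertionCandidates σ = insEmpty ∷ map ins (nonemptyFactors σ)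
                                ++ map insR (nonemptyFactors σ)
                                ++ map insL (nonemptyFactors σ)

length-insertionCandidates : ∀ σ → length (insertionCandidates σ) ≡ suc (3 * length (nonemptyFactors σ))
length-insertionCandidates σ = cong suc (begin
  length (map ins F ++ map insR F ++ map insL F)                      ≡⟨ length-++ (map ins F) ⟩
  length (map ins F) + length (map insR F ++ map insL F)              ≡⟨ cong (length (map ins F) +_) (length-++ (map insR F)) ⟩
  length (map ins F) + (length (map insR F) + length (map insL F))    ≡⟨ cong₂ _+_ (length-map ins F)
                                                                           (cong₂ _+_ (length-map insR F) (length-map insL F)) ⟩
  length F + (length F + length F)                                    ≡⟨ cong (λ k → length F + (length F + k)) (sym (+-identityʳ (length F))) ⟩
  3 * length F                                                        ∎)
  where
  open ≡-Reasoning
  F = nonemptyFactors σ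

InsApplicable⇒∈insertionCandidates : ∀ {σ op} → InsApplicable σ op → op ∈ insertionCandidates σ
InsApplicable⇒∈insertionCandidates {op = insEmpty} _ = here refl
InsApplicable⇒∈insertionCandidates {op = ins f} (_ , f≢[] , factor , _) =
  there (∈-++⁺ˡ (∈-map⁺ ins (IsFactor⇒∈nonemptyFactors f≢[] factor)))
InsApplicable⇒∈insertionCandidates {σ} {insR f} (_ , f≢[] , factor , _) =
  there (∈-++⁺ʳ (map ins (nonemptyFactors σ)) (∈-++⁺ˡ (∈-map⁺ insR (IsFactor⇒∈nonemptyFactors f≢[] factor))))
InsApplicable⇒∈insertionCandidates {σ} {insL f} (_ , f≢[] , factor , _) =
  there (∈-++⁺ʳ (map ins (nonemptyFactors σ)) (∈-++⁺ʳ (map insR (nonemptyFactors σ))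
    (∈-map⁺ insL (IsFactor⇒∈nonemptyFactors f≢[] factor))))

applicable-insertions-count : ∀ σ {ops} → Unique ops → All (InsApplicable σ) ops →
                              length ops ≤ suc (3 * (length σ * length σ))
applicable-insertions-count σ {ops} ops-uniq applicable = begin
  length ops                               ≤⟨ Unique-All⇒length≤ (insertionCandidates σ)
                                                InsApplicable⇒∈insertionCandidates ops-uniq applicable ⟩
  length (insertionCandidates σ)           ≡⟨ length-insertionCandidates σ ⟩
  suc (3 * length (nonemptyFactors σ))     ≤⟨ s≤s (*-monoʳ-≤ 3 (length-nonemptyFactors σ)) ⟩
  suc (3 * (length σ * length σ))          ∎
  where open ≤-Reasoning

-- The right-hand side is 3 * suc n ^ 3 unfolded: the ring solver does not read ℕ's _^_.
cubic-expansion : ∀ n → 1 + 3 * (n * n) + (2 + 9 * n + 6 * (n * n) + 3 * (n * n * n)) ≡ 3 * ((1 + n) * ((1 + n) * ((1 + n) * 1)))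
cubic-expansion = solve-∀

1+3n²≤3[1+n]³ : ∀ n → suc (3 * (n * n)) ≤ 3 * suc n ^ 3
1+3n²≤3[1+n]³ n = subst (suc (3 * (n * n)) ≤_) (cubic-expansion n) (m≤m+n (suc (3 * (n * n))) _)

mainTheorem6 : (T : Tree) →
    ((ops : List DelOp) → Unique ops → All (DelApplicable (Θ T)) ops →
       length ops ≤ vertices T ∸ 1)
    ×
    ((ops : List InsOp) → Unique ops → All (InsApplicable (Θ T)) ops →
       length ops ≤ 3 * vertices T ^ 3)
mainTheorem6 T rewrite vertices≡suc-length-Θ T =
  (λ _ → applicable-deletions-count (Θ T)) ,
  (λ _ ops-uniq applicable →
     ≤-trans (applicable-insertions-count (Θ T) ops-uniq applicable) (1+3n²≤3[1+n]³ (length (Θ T))))
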